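{- Let $n,k,r,s$ be positive integers with $k+r\leq s\leq rk+r-1$ and $n\geq rk+r-1$. Let $\mathcal{H}$ be a stable $r$-graph on the vertex set $[n]$ with $\nu(\mathcal{H})\leq k$. If every edge of $\mathcal{H}$ is contained in at least one $s$-clique of $\mathcal{H}$, then every edge $E\in\mathcal{H}$ satisfies $|E\cap[rk+a-1]|\geq a$, where $a=\lfloor\frac{s-r}{k}\rfloor+1$.
   Context: An $r$-graph on $[n]=\{1,\dots,n\}$ is a family $\mathcal{H}\subseteq\binom{[n]}{r}$. For $s\geq r$, an $s$-clique of $\mathcal{H}$ is an $s$-subset of $[n]$ every $r$-subset of which is an edge. $\nu(\mathcal{H})$ is the maximum number of pairwise disjoint edges. For $1\leq i<j\leq n$ and $E\in\mathcal{H}$, the shifting operator is $S_{ij}(E)=(E\setminus\{j\})\cup\{i\}$ if $j\in E$, $i\notin E$ and $(E\setminus\{j\})\cup\{i\}\notin\mathcal{H}$, and $S_{ij}(E)=E$ otherwise; $S_{ij}(\mathcal{H})=\{S_{ij}(E):E\in\mathcal{H}\}$. $\mathcal{H}$ is stable if $S_{ij}(\mathcal{H})=\mathcal{H}$ for all $1\leq i<j\leq n$. -}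

module Defs where

open import Data.Bool using (Bool; true; false; if_then_else_)
open import Data.Nat using (ℕ; suc; _<ᵇ_; _<_; _≤_)
open import Data.Fin using (Fin; toℕ)
open import Data.Fin.Subset using (Subset; inside; outside; _∩_; _⊆_; ∣_∣)
open import Data.Vec using (lookup; tabulate; _[_]≔_)
open import Data.Product using (Σ; _×_)
open import Data.Empty using (⊥)
open import Relation.Binary.PropositionalEquality using (_≡_; _≢_)
open import Function.Bundles using (_⇔_)

-- Convention: the vertex set [n] = {1,…,n} is represented by Fin n,
-- vertex x : Fin n standing for the integer toℕ x + 1 (order-preserving).

Family : ℕ → Set
Family n = Subset n → Bool

_∈ᶠ_ : ∀ {n} → Subset n → Family n → Set
E ∈ᶠ H = H E ≡ true

IsRGraph : ∀ {n} → ℕ → Family n → Set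
IsRGraph r H = ∀ E → E ∈ᶠ H → ∣ E ∣ ≡ r

emptySet : ∀ {n} → Subset n
emptySet = tabulate (λ _ → outside)

MatchingNumberAtMost : ∀ {n} → Family n → ℕ → Set
MatchingNumberAtMost {n} H k =
  (f : Fin (suc k) → Subset n) →
  (∀ i → f i ∈ᶠ H) →
  (∀ i j → i ≢ j → f i ∩ f j ≡ emptySet) → ⊥

shiftSet : ∀ {n} → Family n → Fin n → Fin n → Subset n → Subset n
shiftSet H i j E with lookup E j | lookup E i
... | true | false =
  let E' = (E [ j ]≔ outside) [ i ]≔ inside in
  if H E' then E else E'
... | _ | _ = E

_∈Shift[_,_]_ : ∀ {n} → Subset n → Fin n → Fin n → Family n → Set
F ∈Shift[ i , j ] H = Σ _ λ E → (E ∈ᶠ H) × (shiftSet H i j E ≡ F)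

Stable : ∀ {n} → Family n → Set
Stable {n} H = ∀ (i j : Fin n) → toℕ i < toℕ j →
  ∀ F → (F ∈Shift[ i , j ] H) ⇔ (F ∈ᶠ H)

IsClique : ∀ {n} → ℕ → Family n → ℕ → Subset n → Set
IsClique r H s C = (∣ C ∣ ≡ s) × (∀ E → E ⊆ C → ∣ E ∣ ≡ r → E ∈ᶠ H)

initSeg : ∀ {n} → ℕ → Subset n
initSeg m = tabulate (λ x → if toℕ x <ᵇ m then inside else outside)

module Submission where

-- Put b = a − 1, m = rk + b, and suppose p = |E ∩ [m]| ≤ b.  With C ⊇ E an s-clique,
-- K = (k+1)b and c = r − b, the k + 1 sets
--   [lb, lb + b) ∪ [K + lc, K + lc + c)   (l < k)     and     [kb, kb + p) ∪ (E ∖ [m])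
-- are pairwise disjoint (low parts lie below K, high parts above) edges, contradicting
-- ν(H) ≤ k.  They are edges by the dominance principle: stability makes H closed under
-- moving a vertex of an edge down to a free vertex, so if every r-subset of C is an edge
-- and G has no more elements than C beyond each threshold t, then G is an edge.

open import Defs
open import Data.Bool using (true; false)
open import Data.Nat using (ℕ; zero; suc; _+_; _*_; _∸_; _≤_; _<_; z≤n; s≤s; z<s; s<s;
  NonZero; >-nonZero; _≤?_; _<?_)
open import Data.Nat.Properties
open import Data.Nat.DivMod using (_/_; m/n*n≤m)
open import Data.Fin using (Fin; toℕ) renaming (zero to fzero; suc to fsuc)
open import Data.Fin.Properties using (toℕ≤pred[n]; toℕ-injective)
open import Data.Fin.Subset using (Subset; inside; outside; _∈_; _⊆_; _∩_; _∪_; ∣_∣; Empty)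
  renaming (⊥ to ∅)
open import Data.Fin.Subset.Properties using (p⊆q⇒∣p∣≤∣q∣; drop-∷-⊆; s⊆s; out⊆;
  drop-∷-Empty; Empty-unique; x∈p∩q⁺; x∈p∩q⁻; x∈p∪q⁻)
open import Data.Vec using ([]; _∷_; lookup; _[_]≔_; here; there)
open import Data.Vec.Properties using (lookup∘update; []≔-idempotent; []≔-lookup)
open import Data.Product using (Σ; _×_; _,_; proj₁; proj₂; swap)
open import Data.Sum using (inj₁; inj₂)
open import Data.Empty using (⊥)
open import Function using (_∘_)
open import Function.Bundles using (Equivalence)
open import Relation.Nullary using (Dec; yes; no; contradiction)
open import Relation.Nullary.Decidable using (decidable-stable)
open import Relation.Binary.Definitions using (tri<; tri≈; tri>)
open import Relation.Binary.PropositionalEquality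
  using (_≡_; _≢_; refl; sym; trans; cong; subst; module ≡-Reasoning)

moveDown : ∀ {n} → Subset n → Fin n → Fin n → Subset n
moveDown X x y = (X [ x ]≔ outside) [ y ]≔ inside

ShiftClosed : ∀ {n} → (Subset n → Set) → Set
ShiftClosed {n} P = ∀ X (x y : Fin n) → toℕ y < toℕ x →
  lookup X x ≡ inside → lookup X y ≡ outside → P X → P (moveDown X x y)

-- For a stable H the moved set is S_yx(X) unless it is already an edge; either way it is an edge.
stable⇒shiftClosed : ∀ {n} {H : Family n} → Stable H → ShiftClosed (_∈ᶠ H)
stable⇒shiftClosed {H = H} stable X x y y<x x∈X y∉X X∈H with H (moveDown X x y) in moved
... | true  = refl
... | false = trans (sym moved) (Equivalence.to (stable y x y<x _) (X , X∈H , shifted))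
  where
  shifted : shiftSet H y x X ≡ moveDown X x y
  shifted rewrite x∈X | y∉X | moved = refl

shiftClosed-∷ : ∀ {n} {P : Subset (suc n) → Set} b → ShiftClosed P → ShiftClosed (P ∘ (b ∷_))
shiftClosed-∷ b closed X x y y<x x∈X y∉X =
  closed (b ∷ X) (fsuc x) (fsuc y) (s<s y<x) x∈X y∉X

tail : ∀ {n} → ℕ → Subset n → Subset n
tail zero    X       = X
tail (suc t) []      = []
tail (suc t) (x ∷ X) = outside ∷ tail t X

infix 4 _≼_
_≼_ : ∀ {n} → Subset n → Subset n → Set
G ≼ F = ∀ t → ∣ tail t G ∣ ≤ ∣ tail t F ∣

Below Above : ∀ {n} → ℕ → Subset n → Set
Below v X = ∀ {i} → i ∈ X → toℕ i < v
Above u X = ∀ {i} → i ∈ X → u ≤ toℕ i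

tail-⊆ : ∀ {n} t (X : Subset n) → tail t X ⊆ X
tail-⊆ zero    X       p         = p
tail-⊆ (suc t) (x ∷ X) (there p) = there (tail-⊆ t X p)

tail-mono : ∀ {n} t {X Y : Subset n} → X ⊆ Y → tail t X ⊆ tail t Y
tail-mono zero    X⊆Y = X⊆Y
tail-mono (suc t) {[]}    {[]}    X⊆Y = X⊆Y
tail-mono (suc t) {x ∷ X} {y ∷ Y} X⊆Y = s⊆s (tail-mono t (drop-∷-⊆ X⊆Y))

tail-antitone : ∀ {n} {t t'} → t ≤ t' → (X : Subset n) → tail t' X ⊆ tail t X
tail-antitone {t' = t'} z≤n X = tail-⊆ t' X
tail-antitone (s≤s t≤t') []      = λ ()
tail-antitone (s≤s t≤t') (x ∷ X) = s⊆s (tail-antitone t≤t' X)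

tail-above : ∀ {n} t (X : Subset n) → Above t (tail t X)
tail-above zero    X       _         = z≤n
tail-above (suc t) (x ∷ X) (there p) = s≤s (tail-above t X p)

tail-deficit : ∀ {n} t (X : Subset n) → ∣ X ∣ ≤ t + ∣ tail t X ∣
tail-deficit zero    X             = ≤-refl
tail-deficit (suc t) []            = z≤n
tail-deficit (suc t) (inside  ∷ X) = s≤s (tail-deficit t X)
tail-deficit (suc t) (outside ∷ X) = m≤n⇒m≤1+n (tail-deficit t X)

prefix-split : ∀ {n} m (X : Subset n) → ∣ X ∩ initSeg m ∣ + ∣ tail m X ∣ ≡ ∣ X ∣
prefix-split zero    []            = refl
prefix-split (suc m) []            = refl
prefix-split zero    (inside  ∷ X) = trans (+-suc _ _) (cong suc (prefix-split 0 X))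
prefix-split zero    (outside ∷ X) = prefix-split 0 X
prefix-split (suc m) (inside  ∷ X) = cong suc (prefix-split m X)
prefix-split (suc m) (outside ∷ X) = prefix-split m X

union-bound : ∀ {n} (A B : Subset n) → ∣ A ∪ B ∣ ≤ ∣ A ∣ + ∣ B ∣
union-bound []            []            = z≤n
union-bound (inside  ∷ A) (inside  ∷ B) =
  s≤s (≤-trans (m≤n⇒m≤1+n (union-bound A B)) (≤-reflexive (sym (+-suc _ _))))
union-bound (inside  ∷ A) (outside ∷ B) = s≤s (union-bound A B)
union-bound (outside ∷ A) (inside  ∷ B) =
  ≤-trans (s≤s (union-bound A B)) (≤-reflexive (sym (+-suc _ _)))
union-bound (outside ∷ A) (outside ∷ B) = union-bound A B

tail-union-bound : ∀ {n} t (A B : Subset n) → ∣ tail t (A ∪ B) ∣ ≤ ∣ tail t A ∣ + ∣ tail t B ∣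
tail-union-bound zero    A       B       = union-bound A B
tail-union-bound (suc t) []      []      = z≤n
tail-union-bound (suc t) (a ∷ A) (b ∷ B) = tail-union-bound t A B

⊆⇒≼ : ∀ {n} {X Y : Subset n} → X ⊆ Y → X ≼ Y
⊆⇒≼ X⊆Y t = p⊆q⇒∣p∣≤∣q∣ (tail-mono t X⊆Y)

≼-trans : ∀ {n} {X Y Z : Subset n} → X ≼ Y → Y ≼ Z → X ≼ Z
≼-trans X≼Y Y≼Z t = ≤-trans (X≼Y t) (Y≼Z t)

missing-element : ∀ {n} (X F : Subset n) → X ⊆ F → ∣ X ∣ < ∣ F ∣ →
  Σ (Fin n) λ j → lookup F j ≡ inside × lookup X j ≡ outside
missing-element []            []            _   ()
missing-element (inside  ∷ X) (outside ∷ F) X⊆F _ with X⊆F here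
... | ()
missing-element (outside ∷ X) (inside  ∷ F) _   _ = fzero , refl , refl
missing-element (inside  ∷ X) (inside  ∷ F) X⊆F (s≤s X<F)
  with missing-element X F (drop-∷-⊆ X⊆F) X<F
... | j , j∈F , j∉X = fsuc j , j∈F , j∉X
missing-element (outside ∷ X) (outside ∷ F) X⊆F X<F
  with missing-element X F (drop-∷-⊆ X⊆F) X<F
... | j , j∈F , j∉X = fsuc j , j∈F , j∉X

insert-size : ∀ {n} (X : Subset n) j → lookup X j ≡ outside → ∣ X [ j ]≔ inside ∣ ≡ suc ∣ X ∣
insert-size (outside ∷ X) fzero    _   = refl
insert-size (outside ∷ X) (fsuc j) j∉X = insert-size X j j∉X
insert-size (inside  ∷ X) (fsuc j) j∉X = cong suc (insert-size X j j∉X)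

insert-⊆ : ∀ {n} {X F : Subset n} j → X ⊆ F → lookup F j ≡ inside → X [ j ]≔ inside ⊆ F
insert-⊆ {X = x ∷ X} {f ∷ F} fzero    X⊆F refl here      = here
insert-⊆ {X = x ∷ X} {f ∷ F} fzero    X⊆F refl (there p) = X⊆F (there p)
insert-⊆ {X = x ∷ X} {f ∷ F} (fsuc j) X⊆F j∈F  here      = X⊆F here
insert-⊆ {X = x ∷ X} {f ∷ F} (fsuc j) X⊆F j∈F  (there p) =
  there (insert-⊆ j (drop-∷-⊆ X⊆F) j∈F p)

-- To get P (inside ∷ X): add a missing element j of F to X, then shift j to the front.
shift-to-front : ∀ {n} (P : Subset (suc n) → Set) → ShiftClosed P →
  {X F : Subset n} → X ⊆ F → ∣ X ∣ < ∣ F ∣ →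
  (∀ Y → Y ⊆ F → ∣ Y ∣ ≡ suc ∣ X ∣ → P (outside ∷ Y)) → P (inside ∷ X)
shift-to-front {n} P closed {X} {F} X⊆F X<F P-below-F with missing-element X F X⊆F X<F
... | j , j∈F , j∉X =
  subst (λ Z → P (inside ∷ Z)) removed
    (closed (outside ∷ Y) (fsuc j) fzero z<s (lookup∘update j X inside) refl
      (P-below-F Y (insert-⊆ j X⊆F j∈F) (insert-size X j j∉X)))
  where
  Y : Subset n
  Y = X [ j ]≔ inside
  removed : Y [ j ]≔ outside ≡ X
  removed = trans ([]≔-idempotent X j) (trans (cong (X [ j ]≔_) (sym j∉X)) ([]≔-lookup X j))

-- Induction on the first vertex; when only G contains it,
-- shift-to-front provides it.
≼-inherits : ∀ {n} (P : Subset n → Set) → ShiftClosed P → (F G : Subset n) →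
  (∀ X → X ⊆ F → ∣ X ∣ ≡ ∣ G ∣ → P X) → G ≼ F → P G
≼-inherits P closed [] [] P-on-F _ = P-on-F [] (λ ()) refl
≼-inherits P closed (inside ∷ F) (inside ∷ G) P-on-F G≼F =
  ≼-inherits (P ∘ (inside ∷_)) (shiftClosed-∷ inside closed) F G
    (λ X X⊆F X-size → P-on-F (inside ∷ X) (s⊆s X⊆F) (cong suc X-size)) (G≼F ∘ suc)
≼-inherits P closed (f ∷ F) (outside ∷ G) P-on-F G≼F =
  ≼-inherits (P ∘ (outside ∷_)) (shiftClosed-∷ outside closed) F G
    (λ X X⊆F X-size → P-on-F (outside ∷ X) (out⊆ X⊆F) X-size) (G≼F ∘ suc)
≼-inherits P closed (outside ∷ F) (inside ∷ G) P-on-F G≼F =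
  ≼-inherits (P ∘ (inside ∷_)) (shiftClosed-∷ inside closed) F G
    (λ X X⊆F X-size → shift-to-front P closed X⊆F (subst (_< ∣ F ∣) (sym X-size) (G≼F 0))
      (λ Y Y⊆F Y-size → P-on-F (outside ∷ Y) (s⊆s Y⊆F) (trans Y-size (cong suc X-size))))
    (G≼F ∘ suc)

-- interval u x = [u, u + x).
interval : ∀ {n} → ℕ → ℕ → Subset n
interval {zero}  _       _       = []
interval {suc n} (suc u) x       = outside ∷ interval u x
interval {suc n} zero    zero    = outside ∷ interval 0 0
interval {suc n} zero    (suc x) = inside ∷ interval 0 x

interval-size : ∀ {n} u x → u + x ≤ n → ∣ interval {n} u x ∣ ≡ x
interval-size {zero}  zero    zero    _         = refl
interval-size {suc n} (suc u) x       (s≤s fit) = interval-size {n} u x fit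
interval-size {suc n} zero    zero    _         = interval-size {n} 0 0 z≤n
interval-size {suc n} zero    (suc x) (s≤s fit) = cong suc (interval-size {n} 0 x fit)

tail-interval : ∀ {n} t u x → ∣ tail t (interval {n} u x) ∣ ≤ u + x ∸ t
tail-interval {zero}  zero    _       _       = z≤n
tail-interval {zero}  (suc t) _       _       = z≤n
tail-interval {suc n} zero    (suc u) x       = m≤n⇒m≤1+n (tail-interval {n} 0 u x)
tail-interval {suc n} zero    zero    zero    = tail-interval {n} 0 0 0
tail-interval {suc n} zero    zero    (suc x) = s≤s (tail-interval {n} 0 0 x)
tail-interval {suc n} (suc t) (suc u) x       = tail-interval {n} t u x
tail-interval {suc n} (suc t) zero    zero    = ≤-trans (tail-interval {n} t 0 0) (≤-reflexive (0∸n≡0 t))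
tail-interval {suc n} (suc t) zero    (suc x) = tail-interval {n} t 0 x

tail-interval-empty : ∀ {n} {t} u x → u + x ≤ t → ∣ tail t (interval {n} u x) ∣ ≡ 0
tail-interval-empty {t = t} u x end≤t =
  n≤0⇒n≡0 (≤-trans (tail-interval t u x) (≤-reflexive (m≤n⇒m∸n≡0 end≤t)))

interval-below : ∀ {n} u x → Below (u + x) (interval {n} u x)
interval-below {suc n} (suc u) x       (there p) = s<s (interval-below u x p)
interval-below {suc n} zero    zero    (there p) = contradiction (interval-below 0 0 p) n≮0
interval-below {suc n} zero    (suc x) here      = z<s
interval-below {suc n} zero    (suc x) (there p) = s<s (interval-below 0 x p)

interval-above : ∀ {n} u x → Above u (interval {n} u x)
interval-above {suc n} (suc u) x (there p) = s≤s (interval-above u x p)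
interval-above {suc n} zero    x _         = z≤n

below-≤ : ∀ {n} {v w} {X : Subset n} → v ≤ w → Below v X → Below w X
below-≤ v≤w X<v i∈X = <-≤-trans (X<v i∈X) v≤w

above-≤ : ∀ {n} {u w} {X : Subset n} → w ≤ u → Above u X → Above w X
above-≤ w≤u u≤X i∈X = ≤-trans w≤u (u≤X i∈X)

interval-≼ : ∀ {n} {u x m} (X : Subset n) → u + x ≤ m → m ≤ n → x ≤ ∣ tail m X ∣ →
  interval u x ≼ X
interval-≼ {n} {u} {x} {m} X end≤m m≤n x≤tail t with t ≤? m
... | yes t≤m = begin
  ∣ tail t I ∣ ≤⟨ p⊆q⇒∣p∣≤∣q∣ (tail-⊆ t I) ⟩
  ∣ I ∣        ≡⟨ interval-size u x (≤-trans end≤m m≤n) ⟩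
  x            ≤⟨ x≤tail ⟩
  ∣ tail m X ∣ ≤⟨ p⊆q⇒∣p∣≤∣q∣ (tail-antitone t≤m X) ⟩
  ∣ tail t X ∣ ∎
  where
  open ≤-Reasoning
  I : Subset n
  I = interval u x
... | no t≰m =
  ≤-trans (≤-reflexive (tail-interval-empty u x (≤-trans end≤m (<⇒≤ (≰⇒> t≰m))))) z≤n

block-≼ : ∀ {n} {u x} {B C : Subset n} → u + x + ∣ B ∣ ≤ ∣ C ∣ → B ≼ C → interval u x ∪ B ≼ C
block-≼ {u = u} {x} {B} {C} fits B≼C t =
  ≤-trans (tail-union-bound t (interval u x) B) (bound (u + x ≤? t))
  where
  open ≤-Reasoning
  bound : Dec (u + x ≤ t) → ∣ tail t (interval u x) ∣ + ∣ tail t B ∣ ≤ ∣ tail t C ∣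
  bound (yes end≤t) =
    ≤-trans (≤-reflexive (cong (_+ ∣ tail t B ∣) (tail-interval-empty u x end≤t))) (B≼C t)
  bound (no end≰t) = +-cancelˡ-≤ t _ _ (begin
    t + (∣ tail t (interval u x) ∣ + ∣ tail t B ∣)
      ≤⟨ +-monoʳ-≤ t (+-mono-≤ (tail-interval t u x) (p⊆q⇒∣p∣≤∣q∣ (tail-⊆ t B))) ⟩
    t + (u + x ∸ t + ∣ B ∣)   ≡⟨ sym (+-assoc t _ ∣ B ∣) ⟩
    t + (u + x ∸ t) + ∣ B ∣   ≡⟨ cong (_+ ∣ B ∣) (m+[n∸m]≡n (<⇒≤ (≰⇒> end≰t))) ⟩
    u + x + ∣ B ∣             ≤⟨ fits ⟩
    ∣ C ∣                     ≤⟨ tail-deficit t C ⟩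
    t + ∣ tail t C ∣          ∎)

Disjoint : ∀ {n} → Subset n → Subset n → Set
Disjoint A B = Empty (A ∩ B)

disjoint-sym : ∀ {n} {A B : Subset n} → Disjoint A B → Disjoint B A
disjoint-sym {A = A} {B} AB (i , i∈B∩A) = AB (i , x∈p∩q⁺ (swap (x∈p∩q⁻ B A i∈B∩A)))

∅≡emptySet : ∀ {n} → ∅ ≡ emptySet {n}
∅≡emptySet {zero}  = refl
∅≡emptySet {suc n} = cong (outside ∷_) ∅≡emptySet

disjoint⇒∩≡∅ : ∀ {n} {A B : Subset n} → Disjoint A B → A ∩ B ≡ emptySet
disjoint⇒∩≡∅ AB = trans (Empty-unique AB) ∅≡emptySet

disjoint-size : ∀ {n} (A B : Subset n) → Disjoint A B → ∣ A ∪ B ∣ ≡ ∣ A ∣ + ∣ B ∣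
disjoint-size []            []            _  = refl
disjoint-size (inside  ∷ A) (inside  ∷ B) AB = contradiction (fzero , here) AB
disjoint-size (inside  ∷ A) (outside ∷ B) AB = cong suc (disjoint-size A B (drop-∷-Empty AB))
disjoint-size (outside ∷ A) (inside  ∷ B) AB =
  trans (cong suc (disjoint-size A B (drop-∷-Empty AB))) (sym (+-suc _ _))
disjoint-size (outside ∷ A) (outside ∷ B) AB = disjoint-size A B (drop-∷-Empty AB)

separated : ∀ {n} {v} {A B : Subset n} → Below v A → Above v B → Disjoint A B
separated {A = A} {B} A<v v≤B (i , i∈A∩B) =
  let i∈A , i∈B = x∈p∩q⁻ A B i∈A∩B in <⇒≱ (A<v i∈A) (v≤B i∈B)

intervals-disjoint : ∀ {n} {u x u' x'} → u + x ≤ u' → Disjoint (interval {n} u x) (interval u' x')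
intervals-disjoint {u = u} {x} {u'} {x'} end≤u' =
  separated (interval-below u x) (above-≤ end≤u' (interval-above u' x'))

zoned-disjoint : ∀ {n} {w} {A A' B B' : Subset n} → Below w A → Below w A' → Above w B → Above w B' →
  Disjoint A A' → Disjoint B B' → Disjoint (A ∪ B) (A' ∪ B')
zoned-disjoint {A = A} {A'} {B} {B'} A<w A'<w w≤B w≤B' AA' BB' (i , i∈)
  with x∈p∩q⁻ (A ∪ B) (A' ∪ B') i∈
... | i∈A∪B , i∈A'∪B' with x∈p∪q⁻ A B i∈A∪B | x∈p∪q⁻ A' B' i∈A'∪B'
... | inj₁ i∈A | inj₁ i∈A' = AA' (i , x∈p∩q⁺ (i∈A , i∈A'))
... | inj₁ i∈A | inj₂ i∈B' = <⇒≱ (A<w i∈A) (w≤B' i∈B')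
... | inj₂ i∈B | inj₁ i∈A' = <⇒≱ (A'<w i∈A') (w≤B i∈B)
... | inj₂ i∈B | inj₂ i∈B' = BB' (i , x∈p∩q⁺ (i∈B , i∈B'))

interval∪-size : ∀ {n} {u x} {B : Subset n} → u + x ≤ n → Above (u + x) B →
  ∣ interval u x ∪ B ∣ ≡ x + ∣ B ∣
interval∪-size {u = u} {x} {B} fit B-above =
  trans (disjoint-size (interval u x) B (separated (interval-below u x) B-above))
        (cong (_+ ∣ B ∣) (interval-size u x fit))

no-large-packing : ∀ {n} {H : Family n} {k} → MatchingNumberAtMost H k → (F : ℕ → Subset n) →
  (∀ l → l ≤ k → F l ∈ᶠ H) → (∀ l l' → l < l' → l' ≤ k → Disjoint (F l) (F l')) → ⊥
no-large-packing ν≤k F edge disjoint = ν≤k (F ∘ toℕ) (λ i → edge (toℕ i) (toℕ≤pred[n] i)) apart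
  where
  apart : ∀ i j → i ≢ j → F (toℕ i) ∩ F (toℕ j) ≡ emptySet
  apart i j i≢j with <-cmp (toℕ i) (toℕ j)
  ... | tri< i<j _ _ = disjoint⇒∩≡∅ (disjoint _ _ i<j (toℕ≤pred[n] j))
  ... | tri≈ _ i≡j _ = contradiction (toℕ-injective i≡j) i≢j
  ... | tri> _ _ j<i = disjoint⇒∩≡∅ (disjoint-sym (disjoint _ _ j<i (toℕ≤pred[n] i)))

blocks-apart : ∀ x {l l'} → l < l' → l * x + x ≤ l' * x
blocks-apart x {l} {l'} l<l' = subst (_≤ l' * x) (+-comm x (l * x)) (*-monoˡ-≤ x l<l')

module Packing {n : ℕ} (H : Family n) (k r s b m : ℕ) {E C : Subset n}
  (closed : ShiftClosed (_∈ᶠ H)) (C-clique : IsClique r H s C)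
  (E⊆C : E ⊆ C) (E-size : ∣ E ∣ ≡ r)
  (fits-clique : k * b + r ≤ s) (b≤r : b ≤ r)
  (fits-prefix : k * b + b + k * (r ∸ b) ≤ m) (m≤n : m ≤ n)
  (few : ∣ E ∩ initSeg m ∣ ≤ b) where

  c K p : ℕ
  c = r ∸ b
  K = k * b + b
  p = ∣ E ∩ initSeg m ∣

  block high low : ℕ → Subset n
  block l = interval (l * b) b
  high  l = interval (K + l * c) c
  low   l = block l ∪ high l

  initial last : Subset n
  initial = interval (k * b) p
  last    = initial ∪ tail m E

  b+c≡r : b + c ≡ r
  b+c≡r = m+[n∸m]≡n b≤r

  K≤m : K ≤ m
  K≤m = ≤-trans (m≤m+n K _) fits-prefix

  block-end : ∀ {l} → l ≤ k → l * b + b ≤ K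
  block-end l≤k = +-monoˡ-≤ b (*-monoˡ-≤ b l≤k)

  high-apart : ∀ {l l'} → l < l' → K + l * c + c ≤ K + l' * c
  high-apart {l} l<l' = ≤-trans (≤-reflexive (+-assoc K (l * c) c)) (+-monoʳ-≤ K (blocks-apart c l<l'))

  high-end : ∀ {l} → l < k → K + l * c + c ≤ m
  high-end l<k = ≤-trans (high-apart l<k) fits-prefix

  initial-end : k * b + p ≤ K
  initial-end = +-monoʳ-≤ (k * b) few

  tail-size : p + ∣ tail m E ∣ ≡ r
  tail-size = trans (prefix-split m E) E-size

  c≤tail : c ≤ ∣ tail m E ∣
  c≤tail = +-cancelˡ-≤ b _ _ (begin
    b + c            ≡⟨ trans b+c≡r (sym tail-size) ⟩
    p + ∣ tail m E ∣ ≤⟨ +-monoˡ-≤ _ few ⟩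
    b + ∣ tail m E ∣ ∎)
    where open ≤-Reasoning

  block-below : ∀ {l} → l ≤ k → Below K (block l)
  block-below {l} l≤k = below-≤ (block-end l≤k) (interval-below (l * b) b)

  high-above : ∀ l → Above K (high l)
  high-above l = above-≤ (m≤m+n K _) (interval-above (K + l * c) c)

  dominated-edge : ∀ {G} → ∣ G ∣ ≡ r → G ≼ C → G ∈ᶠ H
  dominated-edge {G} G-size G≼C =
    ≼-inherits (_∈ᶠ H) closed C G
      (λ X X⊆C X-size → proj₂ C-clique X X⊆C (trans X-size G-size)) G≼C

  layout-edge : ∀ {u x B} → ∣ interval u x ∪ B ∣ ≡ r → u + x + ∣ B ∣ ≤ s → B ≼ C →
    (interval u x ∪ B) ∈ᶠ H
  layout-edge size fits B≼C =
    dominated-edge size (block-≼ (≤-trans fits (≤-reflexive (sym (proj₁ C-clique)))) B≼C)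

  high-size : ∀ {l} → l < k → ∣ high l ∣ ≡ c
  high-size {l} l<k = interval-size (K + l * c) c (≤-trans (high-end l<k) m≤n)

  -- block l ∪ high l: size b + c = r, and (l+1)b + c ≤ kb + r ≤ s; its high part is
  -- dominated by E ∖ [m], which has at least c elements.
  low-edge : ∀ {l} → l < k → low l ∈ᶠ H
  low-edge {l} l<k = layout-edge size fits
    (≼-trans (interval-≼ E (high-end l<k) m≤n c≤tail) (⊆⇒≼ E⊆C))
    where
    open ≤-Reasoning
    block-end≤K : l * b + b ≤ K
    block-end≤K = block-end (<⇒≤ l<k)
    size : ∣ low l ∣ ≡ r
    size = trans (interval∪-size (≤-trans (≤-trans block-end≤K K≤m) m≤n)
                                 (above-≤ (≤-trans block-end≤K (m≤m+n K _)) (interval-above _ c)))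
                 (trans (cong (b +_) (high-size l<k)) b+c≡r)
    fits : l * b + b + ∣ high l ∣ ≤ s
    fits = begin
      l * b + b + ∣ high l ∣   ≡⟨ +-assoc (l * b) b _ ⟩
      l * b + (b + ∣ high l ∣) ≡⟨ cong (λ z → l * b + (b + z)) (high-size l<k) ⟩
      l * b + (b + c)          ≡⟨ cong (l * b +_) b+c≡r ⟩
      l * b + r                ≤⟨ +-monoˡ-≤ r (*-monoˡ-≤ b (<⇒≤ l<k)) ⟩
      k * b + r                ≤⟨ fits-clique ⟩
      s                        ∎

  -- initial ∪ (E ∖ [m]): size p + (r − p) = r, kb + r ≤ s, and E ∖ [m] ⊆ C.
  last-edge : last ∈ᶠ H
  last-edge = layout-edge size fits (⊆⇒≼ (λ i∈ → E⊆C (tail-⊆ m E i∈)))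
    where
    size : ∣ last ∣ ≡ r
    size = trans (interval∪-size (≤-trans (≤-trans initial-end K≤m) m≤n)
                                 (above-≤ (≤-trans initial-end K≤m) (tail-above m E)))
                 tail-size
    fits : k * b + p + ∣ tail m E ∣ ≤ s
    fits = ≤-trans (≤-reflexive (trans (+-assoc (k * b) p _) (cong (k * b +_) tail-size))) fits-clique

  low-disjoint : ∀ {l l'} → l < l' → l' < k → Disjoint (low l) (low l')
  low-disjoint {l} {l'} l<l' l'<k =
    zoned-disjoint (block-below (<⇒≤ (<-trans l<l' l'<k))) (block-below (<⇒≤ l'<k))
      (high-above l) (high-above l')
      (intervals-disjoint (blocks-apart b l<l')) (intervals-disjoint (high-apart l<l'))

  low-last-disjoint : ∀ {l} → l < k → Disjoint (low l) last
  low-last-disjoint {l} l<k =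
    zoned-disjoint (block-below (<⇒≤ l<k)) (below-≤ initial-end (interval-below (k * b) p))
      (high-above l) (above-≤ K≤m (tail-above m E))
      (intervals-disjoint (blocks-apart b l<k))
      (separated (below-≤ (high-end l<k) (interval-below (K + l * c) c)) (tail-above m E))

  packing : ℕ → Subset n
  packing l with l <? k
  ... | yes _ = low l
  ... | no  _ = last

  packing-edge : ∀ l → l ≤ k → packing l ∈ᶠ H
  packing-edge l _ with l <? k
  ... | yes l<k = low-edge l<k
  ... | no  _   = last-edge

  packing-disjoint : ∀ l l' → l < l' → l' ≤ k → Disjoint (packing l) (packing l')
  packing-disjoint l l' l<l' l'≤k with l <? k | l' <? k
  ... | yes _   | yes l'<k = low-disjoint l<l' l'<k
  ... | yes l<k | no  _    = low-last-disjoint l<k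
  ... | no  l≮k | _        = contradiction (<-≤-trans l<l' l'≤k) l≮k

dense-prefix : ∀ {n} (H : Family n) (k r s b m : ℕ) {E : Subset n} →
  ShiftClosed (_∈ᶠ H) → MatchingNumberAtMost H k →
  Σ (Subset n) (λ C → IsClique r H s C × E ⊆ C) → ∣ E ∣ ≡ r →
  k * b + r ≤ s → b ≤ r → k * b + b + k * (r ∸ b) ≤ m → m ≤ n →
  b < ∣ E ∩ initSeg m ∣
dense-prefix H k r s b m {E} closed ν≤k (C , C-clique , E⊆C) E-size fits-clique b≤r fits-prefix m≤n =
  decidable-stable (b <? ∣ E ∩ initSeg m ∣) (λ b≮p → sparse⇒⊥ (≮⇒≥ b≮p))
  where
  sparse⇒⊥ : ∣ E ∩ initSeg m ∣ ≤ b → ⊥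
  sparse⇒⊥ few = no-large-packing {H = H} ν≤k packing packing-edge packing-disjoint
    where open Packing H k r s b m closed C-clique E⊆C E-size fits-clique b≤r fits-prefix m≤n few

quotient-bounds : ∀ k r s .{{_ : NonZero k}} → r ≤ s → s < r * k + r →
  k * ((s ∸ r) / k) + r ≤ s × (s ∸ r) / k < r
quotient-bounds k r s r≤s s<rk+r = fits , *-cancelʳ-< k b r (≤-<-trans bk≤s∸r s∸r<rk)
  where
  open ≤-Reasoning
  b : ℕ
  b = (s ∸ r) / k
  bk≤s∸r : b * k ≤ s ∸ r
  bk≤s∸r = m/n*n≤m (s ∸ r) k
  fits : k * b + r ≤ s
  fits = begin
    k * b + r     ≡⟨ cong (_+ r) (*-comm k b) ⟩
    b * k + r     ≤⟨ +-monoˡ-≤ r bk≤s∸r ⟩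
    s ∸ r + r     ≡⟨ m∸n+n≡m r≤s ⟩
    s             ∎
  s∸r<rk : s ∸ r < r * k
  s∸r<rk = +-cancelʳ-< r (s ∸ r) (r * k) (subst (_< r * k + r) (sym (m∸n+n≡m r≤s)) s<rk+r)

layout-length : ∀ k r b → b ≤ r → k * b + b + k * (r ∸ b) ≡ r * k + b
layout-length k r b b≤r = begin
  k * b + b + k * (r ∸ b)     ≡⟨ +-assoc (k * b) b _ ⟩
  k * b + (b + k * (r ∸ b))   ≡⟨ cong (k * b +_) (+-comm b _) ⟩
  k * b + (k * (r ∸ b) + b)   ≡⟨ sym (+-assoc (k * b) _ b) ⟩
  k * b + k * (r ∸ b) + b     ≡⟨ cong (_+ b) (sym (*-distribˡ-+ k b (r ∸ b))) ⟩
  k * (b + (r ∸ b)) + b       ≡⟨ cong (λ z → k * z + b) (m+[n∸m]≡n b≤r) ⟩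
  k * r + b                   ≡⟨ cong (_+ b) (*-comm k r) ⟩
  r * k + b                   ∎
  where open ≡-Reasoning

proposition3p2 : (n k r s : ℕ) .{{_ : NonZero k}} →
    1 ≤ n → 1 ≤ r → 1 ≤ s →
    k + r ≤ s → s ≤ r * k + r ∸ 1 → r * k + r ∸ 1 ≤ n →
    (H : Family n) → IsRGraph r H → Stable H → MatchingNumberAtMost H k →
    (∀ E → E ∈ᶠ H → Σ (Subset n) λ C → IsClique r H s C × (E ⊆ C)) →
    ∀ E → E ∈ᶠ H →
      (s ∸ r) / k + 1 ≤ ∣ E ∩ initSeg (r * k + ((s ∸ r) / k + 1) ∸ 1) ∣
proposition3p2 n k r s _ 1≤r _ k+r≤s s≤rk+r∸1 rk+r∸1≤n H r-graph stable ν≤k in-clique E E∈H =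
  subst (_≤ ∣ E ∩ initSeg m ∣) (+-comm 1 b)
    (dense-prefix H k r s b m (stable⇒shiftClosed stable) ν≤k (in-clique E E∈H) (r-graph E E∈H)
      fits-clique (<⇒≤ b<r) fits-prefix m≤n)
  where
  b m : ℕ
  b = (s ∸ r) / k
  m = r * k + (b + 1) ∸ 1
  s<rk+r : s < r * k + r
  s<rk+r = m≤pred[n]⇒suc[m]≤n ⦃ >-nonZero (≤-trans 1≤r (m≤n+m r (r * k))) ⦄ s≤rk+r∸1
  bounds : k * b + r ≤ s × b < r
  bounds = quotient-bounds k r s (≤-trans (m≤n+m r k) k+r≤s) s<rk+r
  fits-clique : k * b + r ≤ s
  fits-clique = proj₁ bounds
  b<r : b < r
  b<r = proj₂ bounds
  m≡rk+b : m ≡ r * k + b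
  m≡rk+b = trans (cong (_∸ 1) (sym (+-assoc (r * k) b 1))) (m+n∸n≡m (r * k + b) 1)
  fits-prefix : k * b + b + k * (r ∸ b) ≤ m
  fits-prefix = ≤-reflexive (trans (layout-length k r b (<⇒≤ b<r)) (sym m≡rk+b))
  m≤n : m ≤ n
  m≤n = ≤-trans (∸-monoˡ-≤ 1 (+-monoʳ-≤ (r * k) b+1≤r)) rk+r∸1≤n
    where
    b+1≤r : b + 1 ≤ r
    b+1≤r = subst (_≤ r) (+-comm 1 b) b<r
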